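{- Let $d,q\in\mathbb Z^+$, $n,l\in\mathbb N$, $r,t\in\mathbb Z$ with $t<d$. Then $$\sum_{j\in\mathbb N}(-1)^j\Bigl(\sum_{d\mid k-t}(-1)^k\binom nk\binom{(k-t)/d}j\Bigr)\Bigl(\sum_{q\mid i-r}(-1)^{i}\binom ji\binom{(i-r)/q}l\Bigr)=\sum_{k\equiv dr+t\,(\mathrm{mod}\ dq)}(-1)^k\binom nk\binom{(k-dr-t)/(dq)}l.$$
   Context: $\mathbb N=\{0,1,2,\ldots\}$. Binomial coefficients: $\binom x0=1$, $\binom xk=x(x-1)\cdots(x-k+1)/k!$ for $k\in\mathbb Z^+$ (for rational $x$), and $\binom xk=0$ for negative integers $k$. Sums over $k$ and $i$ run over all integers satisfying the stated divisibility/congruence conditions. -}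

module Defs where

open import Data.Nat as ℕ using (ℕ; zero; suc; _!; NonZero)
open import Data.Nat.Properties using (_!≢0)
open import Data.Integer as ℤ using (ℤ; +_)
open import Data.Integer.Divisibility.Signed using (_∣?_)
open import Data.Rational as ℚ using (ℚ; 0ℚ; 1ℚ; _+_; _*_; _-_; -_)
open import Data.Bool using (if_then_else_)
open import Relation.Nullary.Decidable using (does)

fallingℚ : ℚ → ℕ → ℚ
fallingℚ x zero = 1ℚ
fallingℚ x (suc k) = fallingℚ x k * (x - (+ k ℚ./ 1))

binom : ℚ → ℕ → ℚ
binom x k = fallingℚ x k * ((+ 1) ℚ./ (k !)) {{k !≢0}}

ι : ℤ → ℚ
ι z = z ℚ./ 1

sgn : ℕ → ℚ
sgn zero = 1ℚ
sgn (suc k) = - sgn k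

sumTo : ℕ → (ℕ → ℚ) → ℚ
sumTo zero f = f 0
sumTo (suc N) f = sumTo N f + f (suc N)

sumDiv : ℕ → ℤ → ℤ → (ℕ → ℚ) → ℚ
sumDiv N m a f = sumTo N (λ k → if does (m ∣? ((+ k) ℤ.- a)) then f k else 0ℚ)

quot : ℕ → ℤ → (m : ℕ) → .{{NonZero m}} → ℚ
quot k a m = ((+ k) ℤ.- a) ℚ./ m

module Submission where

-- The inner sum over i is the binomial transform (B u)(j) = Σᵢ (-1)ⁱ C(j,i) u(i) of
-- u(i) = [q ∣ i - r] C((i - r)/q, l). After interchanging the sums over j and k, each k with
-- d ∣ k - t contributes (-1)ᵏ C(n,k) Σⱼ (-1)ʲ C(x,j) (B u)(j) with x = (k - t)/d, a natural
-- number because t < d. Since B is an involution (by induction on m from the consequence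
-- B u (m+1) = B u m - B (u ∘ suc) m of Pascal's rule) this is (-1)ᵏ C(n,k) u(x), and
-- k - (dr + t) = d (x - r) turns u(x) into the k-th term of the right-hand side.
-- All sums over j are finite: C(x,j) = 0 for j > x, and x ≤ n + |t|.

open import Defs
open import Data.Nat as ℕ
  using (ℕ; zero; suc; NonZero; _≥_; _≤_; _<_; s≤s; _!; _≤′_; ≤′-refl; ≤′-step)
open import Data.Nat.Properties as ℕP using (m*n≢0; _!≢0)
open import Data.Integer as ℤ using (ℤ; +_; -[1+_])
import Data.Integer.Properties as ℤP
open import Data.Integer.Divisibility.Signed
  using (_∣_; divides; _∣?_; ∣-refl; ∣-trans; ∣m⇒∣m*n; ∣m∣n⇒∣m+n; *-monoʳ-∣; *-cancelˡ-∣)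
import Data.Integer.Tactic.RingSolver as ℤ-Solver
open import Data.Rational as ℚ using (ℚ; 0ℚ; 1ℚ; _+_; _*_; _-_; -_; _/_; toℚᵘ)
import Data.Rational.Properties as ℚP
import Data.Rational.Unnormalised as ℚᵘ
import Data.Rational.Unnormalised.Properties as ℚᵘP
open import Data.Bool using (true; false; if_then_else_)
open import Data.Product using (∃; _,_)
open import Data.Empty using (⊥-elim)
open import Function using (_∘_; _⇔_; mk⇔)
open import Level using (0ℓ)
open import Relation.Nullary using (¬_; yes; no)
open import Relation.Nullary.Decidable using (dec⇒maybe; does; dec-true; dec-false; does-⇔)
open import Relation.Binary.PropositionalEquality
open import Tactic.RingSolver using (solve-∀)
open import Tactic.RingSolver.Core.AlmostCommutativeRing
  using (AlmostCommutativeRing; fromCommutativeRing)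

-- The zero test lets the solver cancel constants such as 1ℚ - 1ℚ.
ℚ-ring : AlmostCommutativeRing 0ℓ 0ℓ
ℚ-ring = fromCommutativeRing ℚP.+-*-commutativeRing (dec⇒maybe ∘ (0ℚ ℚP.≟_))

*-zero-middle : ∀ a b → a * 0ℚ * b ≡ 0ℚ
*-zero-middle a b = trans (cong (_* b) (ℚP.*-zeroʳ a)) (ℚP.*-zeroˡ b)

/-cross : ∀ i j a b .{{_ : NonZero a}} .{{_ : NonZero b}} →
          i ℤ.* + b ≡ j ℤ.* + a → i / a ≡ j / b
/-cross i j (suc a) (suc b) eq = ℚP.fromℚᵘ-cong {ℚᵘ.mkℚᵘ i a} {ℚᵘ.mkℚᵘ j b} (ℚᵘ.*≡* eq)

private
  toℚᵘ-/ : ∀ i a → toℚᵘ (i / suc a) ℚᵘ.≃ ℚᵘ.mkℚᵘ i a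
  toℚᵘ-/ i a = ℚP.toℚᵘ-fromℚᵘ (ℚᵘ.mkℚᵘ i a)

/-+-/ : ∀ i j a b .{{_ : NonZero a}} .{{_ : NonZero b}} →
        i / a + j / b ≡ ((i ℤ.* + b ℤ.+ j ℤ.* + a) / (a ℕ.* b)) {{m*n≢0 a b}}
/-+-/ i j (suc a) (suc b) = ℚP.toℚᵘ-injective
  (ℚᵘP.≃-trans (ℚP.toℚᵘ-homo-+ (i / suc a) (j / suc b))
  (ℚᵘP.≃-trans (ℚᵘP.+-cong (toℚᵘ-/ i a) (toℚᵘ-/ j b))
               (ℚᵘP.≃-sym (toℚᵘ-/ (i ℤ.* + suc b ℤ.+ j ℤ.* + suc a) (b ℕ.+ a ℕ.* suc b)))))

/-*-/ : ∀ i j a b .{{_ : NonZero a}} .{{_ : NonZero b}} →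
        (i / a) * (j / b) ≡ ((i ℤ.* j) / (a ℕ.* b)) {{m*n≢0 a b}}
/-*-/ i j (suc a) (suc b) = ℚP.toℚᵘ-injective
  (ℚᵘP.≃-trans (ℚP.toℚᵘ-homo-* (i / suc a) (j / suc b))
  (ℚᵘP.≃-trans (ℚᵘP.*-cong (toℚᵘ-/ i a) (toℚᵘ-/ j b))
               (ℚᵘP.≃-sym (toℚᵘ-/ (i ℤ.* j) (b ℕ.+ a ℕ.* suc b)))))

ι-suc : ∀ n → ι (+ suc n) ≡ ι (+ n) + 1ℚ
ι-suc n = sym (trans (/-+-/ (+ n) (+ 1) 1 1)
                     (/-cross (+ n ℤ.* + 1 ℤ.+ + 1 ℤ.* + 1) (+ 1 ℤ.+ + n) 1 1 (cross (+ n))))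
  where
  cross : ∀ m → (m ℤ.* + 1 ℤ.+ + 1 ℤ.* + 1) ℤ.* + 1 ≡ (+ 1 ℤ.+ m) ℤ.* + 1
  cross = ℤ-Solver.solve-∀

factorial⁻¹ : ℕ → ℚ
factorial⁻¹ k = ((+ 1) / (k !)) {{k !≢0}}

factorial⁻¹-suc : ∀ k → factorial⁻¹ (suc k) * ι (+ suc k) ≡ factorial⁻¹ k
factorial⁻¹-suc k = trans (/-*-/ (+ 1) (+ suc k) (suc k !) 1 {{suc k !≢0}})
  (/-cross (+ 1 ℤ.* + suc k) (+ 1) (suc k ! ℕ.* 1) (k !)
           {{m*n≢0 (suc k !) 1 {{suc k !≢0}}}} {{k !≢0}} cross)
  where
  open ≡-Reasoning
  cross : + 1 ℤ.* + suc k ℤ.* + (k !) ≡ + 1 ℤ.* + (suc k ! ℕ.* 1)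
  cross = begin
    + 1 ℤ.* + suc k ℤ.* + (k !) ≡⟨ cong (ℤ._* + (k !)) (ℤP.*-identityˡ (+ suc k)) ⟩
    + suc k ℤ.* + (k !)         ≡⟨ ℤP.pos-* (suc k) (k !) ⟨
    + (suc k !)                 ≡⟨ cong +_ (ℕP.*-identityʳ (suc k !)) ⟨
    + (suc k ! ℕ.* 1)           ≡⟨ ℤP.*-identityˡ _ ⟨
    + 1 ℤ.* + (suc k ! ℕ.* 1)   ∎

fallingℚ-suc-+1 : ∀ x k → fallingℚ (x + 1ℚ) (suc k) ≡ (x + 1ℚ) * fallingℚ x k
fallingℚ-suc-+1 x zero = base x
  where
  base : ∀ x → 1ℚ * ((x + 1ℚ) - 0ℚ) ≡ (x + 1ℚ) * 1ℚ
  base = solve-∀ ℚ-ring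
fallingℚ-suc-+1 x (suc k) = begin
  fallingℚ (x + 1ℚ) (suc k) * ((x + 1ℚ) - ι (+ suc k))
    ≡⟨ cong₂ (λ f y → f * ((x + 1ℚ) - y)) (fallingℚ-suc-+1 x k) (ι-suc k) ⟩
  (x + 1ℚ) * fallingℚ x k * ((x + 1ℚ) - (ι (+ k) + 1ℚ))
    ≡⟨ step x (fallingℚ x k) (ι (+ k)) ⟩
  (x + 1ℚ) * (fallingℚ x k * (x - ι (+ k))) ∎
  where
  open ≡-Reasoning
  step : ∀ x f y → (x + 1ℚ) * f * ((x + 1ℚ) - (y + 1ℚ)) ≡ (x + 1ℚ) * (f * (x - y))
  step = solve-∀ ℚ-ring

binom-pascal : ∀ x k → binom (x + 1ℚ) (suc k) ≡ binom x k + binom x (suc k)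
binom-pascal x k = begin
  fallingℚ (x + 1ℚ) (suc k) * e′    ≡⟨ cong (_* e′) (fallingℚ-suc-+1 x k) ⟩
  (x + 1ℚ) * f * e′                 ≡⟨ split x f (ι (+ k)) e′ ⟩
  f * (e′ * (ι (+ k) + 1ℚ)) + f * (x - ι (+ k)) * e′
    ≡⟨ cong (λ z → f * z + f * (x - ι (+ k)) * e′)
            (trans (cong (e′ *_) (sym (ι-suc k))) (factorial⁻¹-suc k)) ⟩
  f * factorial⁻¹ k + f * (x - ι (+ k)) * e′ ∎
  where
  open ≡-Reasoning
  f e′ : ℚ
  f = fallingℚ x k
  e′ = factorial⁻¹ (suc k)
  split : ∀ x f y e → (x + 1ℚ) * f * e ≡ f * (e * (y + 1ℚ)) + f * (x - y) * e
  split = solve-∀ ℚ-ring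

choose : ℕ → ℕ → ℚ
choose n k = binom (ι (+ n)) k

choose-suc-suc : ∀ n k → choose (suc n) (suc k) ≡ choose n k + choose n (suc k)
choose-suc-suc n k = trans (cong (λ y → binom y (suc k)) (ι-suc n)) (binom-pascal (ι (+ n)) k)

fallingℚ-0-suc : ∀ k → fallingℚ 0ℚ (suc k) ≡ 0ℚ
fallingℚ-0-suc zero    = refl
fallingℚ-0-suc (suc k) =
  trans (cong (_* (0ℚ - ι (+ suc k))) (fallingℚ-0-suc k)) (ℚP.*-zeroˡ (0ℚ - ι (+ suc k)))

choose-vanish : ∀ {n k} → n < k → choose n k ≡ 0ℚ
choose-vanish {zero}  {suc k} _       =
  trans (cong (_* factorial⁻¹ (suc k)) (fallingℚ-0-suc k)) (ℚP.*-zeroˡ (factorial⁻¹ (suc k)))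
choose-vanish {suc n} {suc k} (s≤s p) = begin
  choose (suc n) (suc k)         ≡⟨ choose-suc-suc n k ⟩
  choose n k + choose n (suc k)  ≡⟨ cong₂ _+_ (choose-vanish p) (choose-vanish (ℕP.m<n⇒m<1+n p)) ⟩
  0ℚ + 0ℚ                        ≡⟨ ℚP.+-identityˡ 0ℚ ⟩
  0ℚ                             ∎
  where open ≡-Reasoning

sumTo-cong : ∀ N {f g : ℕ → ℚ} → (∀ j → j ≤ N → f j ≡ g j) → sumTo N f ≡ sumTo N g
sumTo-cong zero    f≗g = f≗g 0 ℕ.z≤n
sumTo-cong (suc N) f≗g =
  cong₂ _+_ (sumTo-cong N (λ j j≤N → f≗g j (ℕP.m≤n⇒m≤1+n j≤N))) (f≗g (suc N) ℕP.≤-refl)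

sumTo-0 : ∀ N → sumTo N (λ _ → 0ℚ) ≡ 0ℚ
sumTo-0 zero    = refl
sumTo-0 (suc N) = cong (_+ 0ℚ) (sumTo-0 N)

sumTo-+ : ∀ N (f g : ℕ → ℚ) → sumTo N (λ j → f j + g j) ≡ sumTo N f + sumTo N g
sumTo-+ zero    f g = refl
sumTo-+ (suc N) f g = trans (cong (_+ (f (suc N) + g (suc N))) (sumTo-+ N f g))
  (interchange (sumTo N f) (sumTo N g) (f (suc N)) (g (suc N)))
  where
  interchange : ∀ a b c d → (a + b) + (c + d) ≡ (a + c) + (b + d)
  interchange = solve-∀ ℚ-ring

sumTo-- : ∀ N (f g : ℕ → ℚ) → sumTo N (λ j → f j - g j) ≡ sumTo N f - sumTo N g
sumTo-- zero    f g = refl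
sumTo-- (suc N) f g = trans (cong (_+ (f (suc N) - g (suc N))) (sumTo-- N f g))
  (interchange (sumTo N f) (sumTo N g) (f (suc N)) (g (suc N)))
  where
  interchange : ∀ a b c d → (a - b) + (c - d) ≡ (a + c) - (b + d)
  interchange = solve-∀ ℚ-ring

sumTo-*ˡ : ∀ N a (f : ℕ → ℚ) → sumTo N (λ j → a * f j) ≡ a * sumTo N f
sumTo-*ˡ zero    a f = refl
sumTo-*ˡ (suc N) a f = trans (cong (_+ a * f (suc N)) (sumTo-*ˡ N a f))
                             (sym (ℚP.*-distribˡ-+ a (sumTo N f) (f (suc N))))

sumTo-*ʳ : ∀ N a (f : ℕ → ℚ) → sumTo N (λ j → f j * a) ≡ sumTo N f * a
sumTo-*ʳ zero    a f = refl
sumTo-*ʳ (suc N) a f = trans (cong (_+ f (suc N) * a) (sumTo-*ʳ N a f))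
                             (sym (ℚP.*-distribʳ-+ a (sumTo N f) (f (suc N))))

sumTo-*ˡʳ : ∀ N a b (f : ℕ → ℚ) → a * sumTo N f * b ≡ sumTo N (λ k → a * f k * b)
sumTo-*ˡʳ N a b f = trans (cong (_* b) (sym (sumTo-*ˡ N a f))) (sym (sumTo-*ʳ N b (λ k → a * f k)))

sumTo-suc-head : ∀ N (f : ℕ → ℚ) → sumTo (suc N) f ≡ f 0 + sumTo N (f ∘ suc)
sumTo-suc-head zero    f = refl
sumTo-suc-head (suc N) f =
  trans (cong (_+ f (suc (suc N))) (sumTo-suc-head N f)) (ℚP.+-assoc (f 0) _ _)

sumTo-vanishing-tail : ∀ {x M} (f : ℕ → ℚ) → (∀ j → x < j → f j ≡ 0ℚ) → x ≤′ M →
                       sumTo M f ≡ sumTo x f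
sumTo-vanishing-tail f tail ≤′-refl        = refl
sumTo-vanishing-tail f tail (≤′-step x≤′M) =
  trans (cong₂ _+_ (sumTo-vanishing-tail f tail x≤′M) (tail _ (s≤s (ℕP.≤′⇒≤ x≤′M))))
        (ℚP.+-identityʳ _)

sumTo-swap : ∀ M N (F : ℕ → ℕ → ℚ) →
             sumTo M (λ j → sumTo N (F j)) ≡ sumTo N (λ k → sumTo M (λ j → F j k))
sumTo-swap zero    N F = refl
sumTo-swap (suc M) N F = trans (cong (_+ sumTo N (F (suc M))) (sumTo-swap M N F))
                               (sym (sumTo-+ N (λ k → sumTo M (λ j → F j k)) (F (suc M))))

binomialTransform : (ℕ → ℚ) → ℕ → ℚ
binomialTransform u m = sumTo m (λ i → sgn i * choose m i * u i)

binomialTransform-extend : ∀ u {m M} → m ≤ M →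
                           sumTo M (λ i → sgn i * choose m i * u i) ≡ binomialTransform u m
binomialTransform-extend u {m} m≤M = sumTo-vanishing-tail _ vanish (ℕP.≤⇒≤′ m≤M)
  where
  vanish : ∀ i → m < i → sgn i * choose m i * u i ≡ 0ℚ
  vanish i m<i = trans (cong (λ c → sgn i * c * u i) (choose-vanish m<i)) (*-zero-middle (sgn i) (u i))

binomialTransform-cong : ∀ m {u v : ℕ → ℚ} → (∀ i → u i ≡ v i) →
                         binomialTransform u m ≡ binomialTransform v m
binomialTransform-cong m u≗v = sumTo-cong m (λ i _ → cong (sgn i * choose m i *_) (u≗v i))

binomialTransform-- : ∀ m u v →
  binomialTransform (λ i → u i - v i) m ≡ binomialTransform u m - binomialTransform v m
binomialTransform-- m u v =
  trans (sumTo-cong m (λ i _ → distrib (sgn i * choose m i) (u i) (v i)))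
        (sumTo-- m (λ i → sgn i * choose m i * u i) (λ i → sgn i * choose m i * v i))
  where
  distrib : ∀ c a b → c * (a - b) ≡ c * a - c * b
  distrib = solve-∀ ℚ-ring

binomialTransform-head : ∀ u {m M} → m ≤ suc M →
  binomialTransform u m ≡ u 0 + sumTo M (λ i → sgn (suc i) * choose m (suc i) * u (suc i))
binomialTransform-head u {m} {M} m≤1+M = begin
  binomialTransform u m             ≡⟨ binomialTransform-extend u m≤1+M ⟨
  sumTo (suc M) term                ≡⟨ sumTo-suc-head M term ⟩
  1ℚ * u 0 + sumTo M (term ∘ suc)   ≡⟨ cong (_+ sumTo M (term ∘ suc)) (ℚP.*-identityˡ (u 0)) ⟩
  u 0 + sumTo M (term ∘ suc)        ∎
  where
  open ≡-Reasoning
  term : ℕ → ℚ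
  term i = sgn i * choose m i * u i

binomialTransform-suc : ∀ u m →
  binomialTransform u (suc m) ≡ binomialTransform u m - binomialTransform (u ∘ suc) m
binomialTransform-suc u m = begin
  binomialTransform u (suc m)
    ≡⟨ binomialTransform-head u {M = m} ℕP.≤-refl ⟩
  u 0 + sumTo m (λ i → sgn (suc i) * choose (suc m) (suc i) * u (suc i))
    ≡⟨ cong (λ s → u 0 + s) (sumTo-cong m (λ i _ → pascal-term i)) ⟩
  u 0 + sumTo m (λ i → tail i - sgn i * choose m i * u (suc i))
    ≡⟨ cong (λ s → u 0 + s) (sumTo-- m tail (λ i → sgn i * choose m i * u (suc i))) ⟩
  u 0 + (sumTo m tail - binomialTransform (u ∘ suc) m)
    ≡⟨ ℚP.+-assoc (u 0) (sumTo m tail) (- binomialTransform (u ∘ suc) m) ⟨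
  u 0 + sumTo m tail - binomialTransform (u ∘ suc) m
    ≡⟨ cong (_- binomialTransform (u ∘ suc) m) (binomialTransform-head u (ℕP.n≤1+n m)) ⟨
  binomialTransform u m - binomialTransform (u ∘ suc) m ∎
  where
  open ≡-Reasoning
  tail : ℕ → ℚ
  tail i = sgn (suc i) * choose m (suc i) * u (suc i)
  distrib : ∀ s a b v → (- s) * (a + b) * v ≡ (- s) * b * v - s * a * v
  distrib = solve-∀ ℚ-ring
  pascal-term : ∀ i → sgn (suc i) * choose (suc m) (suc i) * u (suc i)
                      ≡ tail i - sgn i * choose m i * u (suc i)
  pascal-term i = trans (cong (λ c → sgn (suc i) * c * u (suc i)) (choose-suc-suc m i))
                        (distrib (sgn i) (choose m i) (choose m (suc i)) (u (suc i)))

binomialTransform-involutive : ∀ m u → binomialTransform (binomialTransform u) m ≡ u m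
binomialTransform-involutive zero    u = trans (ℚP.*-identityˡ _) (ℚP.*-identityˡ (u 0))
binomialTransform-involutive (suc m) u = begin
  B (B u) (suc m)                    ≡⟨ binomialTransform-suc (B u) m ⟩
  B (B u) m - B (B u ∘ suc) m        ≡⟨ binomialTransform-- m (B u) (B u ∘ suc) ⟨
  B (λ j → B u j - B u (suc j)) m    ≡⟨ binomialTransform-cong m difference ⟩
  B (B (u ∘ suc)) m                  ≡⟨ binomialTransform-involutive m (u ∘ suc) ⟩
  u (suc m)                          ∎
  where
  open ≡-Reasoning
  B : (ℕ → ℚ) → ℕ → ℚ
  B = binomialTransform
  cancel : ∀ a b → a - (a - b) ≡ b
  cancel = solve-∀ ℚ-ring
  difference : ∀ j → B u j - B u (suc j) ≡ B (u ∘ suc) j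
  difference j = trans (cong (λ s → B u j - s) (binomialTransform-suc u j))
                       (cancel (B u j) (B (u ∘ suc) j))

binomialTransform-inversion : ∀ u {x M} → x ≤ M →
  sumTo M (λ j → sgn j * choose x j * binomialTransform u j) ≡ u x
binomialTransform-inversion u {x} x≤M =
  trans (binomialTransform-extend (binomialTransform u) x≤M) (binomialTransform-involutive x u)

-- sumDiv N m a f unfolds to sumTo N (restrict m a f).
restrict : ℤ → ℤ → (ℕ → ℚ) → ℕ → ℚ
restrict m a f i = if does (m ∣? (+ i ℤ.- a)) then f i else 0ℚ

module _ (m a : ℤ) (f : ℕ → ℚ) {i : ℕ} where

  restrict-yes : m ∣ (+ i ℤ.- a) → restrict m a f i ≡ f i
  restrict-yes m∣ = cong (if_then f i else 0ℚ) (dec-true (m ∣? (+ i ℤ.- a)) m∣)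

  restrict-no : ¬ m ∣ (+ i ℤ.- a) → restrict m a f i ≡ 0ℚ
  restrict-no m∤ = cong (if_then f i else 0ℚ) (dec-false (m ∣? (+ i ℤ.- a)) m∤)

  restrict-*ˡ : ∀ (c : ℕ → ℚ) → restrict m a (λ j → c j * f j) i ≡ c i * restrict m a f i
  restrict-*ˡ c = if-*ˡ (does (m ∣? (+ i ℤ.- a)))
    where
    if-*ˡ : ∀ b → (if b then c i * f i else 0ℚ) ≡ c i * (if b then f i else 0ℚ)
    if-*ˡ true  = refl
    if-*ˡ false = sym (ℚP.*-zeroʳ (c i))

restrict-cong : ∀ m a (f : ℕ → ℚ) m′ a′ (f′ : ℕ → ℚ) {i i′ : ℕ} →
                m ∣ (+ i ℤ.- a) ⇔ m′ ∣ (+ i′ ℤ.- a′) → f i ≡ f′ i′ →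
                restrict m a f i ≡ restrict m′ a′ f′ i′
restrict-cong m a f m′ a′ f′ {i} {i′} P⇔Q f≡f′ =
  cong₂ (λ b v → if b then v else 0ℚ) (does-⇔ P⇔Q (m ∣? (+ i ℤ.- a)) (m′ ∣? (+ i′ ℤ.- a′))) f≡f′

∣⇒ℕ-quotient : ∀ {d k t} → t ℤ.< + d → + d ∣ (+ k ℤ.- t) → ∃ λ x → + k ℤ.- t ≡ + x ℤ.* + d
∣⇒ℕ-quotient t<d (divides (+ x) k-t≡xd) = x , k-t≡xd
∣⇒ℕ-quotient {d} {k} {t} t<d (divides -[1+ m ] k-t≡xd) =
  ⊥-elim (ℕP.<⇒≱ (ℤP.drop‿+<+ (subst (ℤ._< + d) t≡ t<d)) d≤)
  where
  open ≡-Reasoning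
  recover : ∀ k t → t ≡ k ℤ.- (k ℤ.- t)
  recover = ℤ-Solver.solve-∀
  t≡ : t ≡ + (k ℕ.+ suc m ℕ.* d)
  t≡ = begin
    t                           ≡⟨ recover (+ k) t ⟩
    + k ℤ.- (+ k ℤ.- t)         ≡⟨ cong (λ z → + k ℤ.- z) k-t≡xd ⟩
    + k ℤ.- -[1+ m ] ℤ.* + d    ≡⟨ cong (λ z → + k ℤ.+ z) (ℤP.neg-distribˡ-* -[1+ m ] (+ d)) ⟩
    + k ℤ.+ + suc m ℤ.* + d     ≡⟨ cong (λ z → + k ℤ.+ z) (ℤP.pos-* (suc m) d) ⟨
    + k ℤ.+ + (suc m ℕ.* d)     ≡⟨ ℤP.pos-+ k (suc m ℕ.* d) ⟨
    + (k ℕ.+ suc m ℕ.* d)       ∎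
  d≤ : d ≤ k ℕ.+ suc m ℕ.* d
  d≤ = ℕP.≤-trans (ℕP.m≤m+n d (m ℕ.* d)) (ℕP.m≤n+m (suc m ℕ.* d) k)

quotient-bound : ∀ {d k t x} .{{_ : NonZero d}} → + k ℤ.- t ≡ + x ℤ.* + d → x ≤ k ℕ.+ ℤ.∣ t ∣
quotient-bound {d} {k} {t} {x} k-t≡xd = begin
  x                   ≤⟨ ℕP.m≤m*n x d ⟩
  x ℕ.* d             ≡⟨ ℤP.abs-* (+ x) (+ d) ⟨
  ℤ.∣ + x ℤ.* + d ∣   ≡⟨ cong ℤ.∣_∣ k-t≡xd ⟨
  ℤ.∣ + k ℤ.- t ∣     ≤⟨ ℤP.∣i-j∣≤∣i∣+∣j∣ (+ k) t ⟩
  k ℕ.+ ℤ.∣ t ∣       ∎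
  where open ℕP.≤-Reasoning

rescaled-residue : ∀ {k t x} d r → k ℤ.- t ≡ x ℤ.* d → k ℤ.- (d ℤ.* r ℤ.+ t) ≡ d ℤ.* (x ℤ.- r)
rescaled-residue {k} {t} {x} d r k-t≡xd =
  trans (regroup k t d r) (trans (cong (λ z → z ℤ.- d ℤ.* r) k-t≡xd) (factor x d r))
  where
  regroup : ∀ k t d r → k ℤ.- (d ℤ.* r ℤ.+ t) ≡ (k ℤ.- t) ℤ.- d ℤ.* r
  regroup = ℤ-Solver.solve-∀
  factor : ∀ x d r → x ℤ.* d ℤ.- d ℤ.* r ≡ d ℤ.* (x ℤ.- r)
  factor = ℤ-Solver.solve-∀

module _ (d q : ℕ) .{{_ : NonZero d}} .{{_ : NonZero q}} (n l : ℕ) (r t : ℤ) where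

  private instance
    dq≢0 : NonZero (d ℕ.* q)
    dq≢0 = m*n≢0 d q

  residue : ℤ
  residue = + d ℤ.* r ℤ.+ t

  coefficient : ℕ → ℚ
  coefficient k = sgn k * choose n k

  innerTerm : ℕ → ℚ
  innerTerm i = binom (quot i r q) l

  outerTerm : ℕ → ℕ → ℚ
  outerTerm j k = coefficient k * binom (quot k t d) j

  targetTerm : ℕ → ℚ
  targetTerm k = coefficient k * binom (quot k residue (d ℕ.* q)) l

  inner : ℕ → ℚ
  inner = restrict (+ q) r innerTerm

  outer : ℕ → ℕ → ℚ
  outer j = restrict (+ d) t (outerTerm j)

  target : ℕ → ℚ
  target = restrict (+ (d ℕ.* q)) residue targetTerm

  inner-sum : ∀ j → sumDiv j (+ q) r (λ i → sgn i * choose j i * innerTerm i)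
                    ≡ binomialTransform inner j
  inner-sum j = sumTo-cong j (λ i _ → restrict-*ˡ (+ q) r innerTerm (λ i → sgn i * choose j i))

  dq∣⇒d∣ : ∀ k → + (d ℕ.* q) ∣ (+ k ℤ.- residue) → + d ∣ (+ k ℤ.- t)
  dq∣⇒d∣ k dq∣ = subst (+ d ∣_) (sym (regroup (+ k) t (+ d) r))
    (∣m∣n⇒∣m+n (∣-trans d∣dq dq∣) (∣m⇒∣m*n r ∣-refl))
    where
    regroup : ∀ k t d r → k ℤ.- t ≡ (k ℤ.- (d ℤ.* r ℤ.+ t)) ℤ.+ d ℤ.* r
    regroup = ℤ-Solver.solve-∀
    d∣dq : + d ∣ + (d ℕ.* q)
    d∣dq = divides (+ q) (trans (ℤP.pos-* d q) (ℤP.*-comm (+ d) (+ q)))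

  module _ {k x : ℕ} (k-t≡xd : + k ℤ.- t ≡ + x ℤ.* + d) where

    k-residue≡d[x-r] : + k ℤ.- residue ≡ + d ℤ.* (+ x ℤ.- r)
    k-residue≡d[x-r] = rescaled-residue {+ k} {t} {+ x} (+ d) r k-t≡xd

    residue-⇔ : + q ∣ (+ x ℤ.- r) ⇔ + (d ℕ.* q) ∣ (+ k ℤ.- residue)
    residue-⇔ = mk⇔
      (λ q∣ → subst₂ _∣_ (sym (ℤP.pos-* d q)) (sym k-residue≡d[x-r]) (*-monoʳ-∣ (+ d) q∣))
      (λ dq∣ → *-cancelˡ-∣ (+ d) (subst₂ _∣_ (ℤP.pos-* d q) k-residue≡d[x-r] dq∣))

    quot-exact : quot k t d ≡ ι (+ x)
    quot-exact = /-cross (+ k ℤ.- t) (+ x) d 1 (trans (ℤP.*-identityʳ _) k-t≡xd)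

    quot-rescale : quot x r q ≡ quot k residue (d ℕ.* q)
    quot-rescale = /-cross (+ x ℤ.- r) (+ k ℤ.- residue) q (d ℕ.* q) (begin
      (+ x ℤ.- r) ℤ.* + (d ℕ.* q)       ≡⟨ cong ((+ x ℤ.- r) ℤ.*_) (ℤP.pos-* d q) ⟩
      (+ x ℤ.- r) ℤ.* (+ d ℤ.* + q)     ≡⟨ reassociate (+ x ℤ.- r) (+ d) (+ q) ⟩
      + d ℤ.* (+ x ℤ.- r) ℤ.* + q       ≡⟨ cong (ℤ._* + q) k-residue≡d[x-r] ⟨
      (+ k ℤ.- residue) ℤ.* + q         ∎)
      where
      open ≡-Reasoning
      reassociate : ∀ a b c → a ℤ.* (b ℤ.* c) ≡ b ℤ.* a ℤ.* c
      reassociate = ℤ-Solver.solve-∀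

    column-sum-on : ∀ {M} → x ≤ M →
                    sumTo M (λ j → sgn j * outer j k * binomialTransform inner j) ≡ target k
    column-sum-on {M} x≤M = begin
      sumTo M (λ j → sgn j * outer j k * B j)
        ≡⟨ sumTo-cong M (λ j _ → factor-out j) ⟩
      sumTo M (λ j → coefficient k * (sgn j * choose x j * B j))
        ≡⟨ sumTo-*ˡ M (coefficient k) (λ j → sgn j * choose x j * B j) ⟩
      coefficient k * sumTo M (λ j → sgn j * choose x j * B j)
        ≡⟨ cong (coefficient k *_) (binomialTransform-inversion inner x≤M) ⟩
      coefficient k * inner x
        ≡⟨ restrict-*ˡ (+ q) r innerTerm (λ _ → coefficient k) ⟨
      restrict (+ q) r (λ i → coefficient k * innerTerm i) x
        ≡⟨ restrict-cong (+ q) r (λ i → coefficient k * innerTerm i) (+ (d ℕ.* q)) residue targetTerm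
                         residue-⇔ (cong (λ z → coefficient k * binom z l) quot-rescale) ⟩
      target k
        ∎
      where
      open ≡-Reasoning
      B : ℕ → ℚ
      B = binomialTransform inner
      rearrange : ∀ s a c b → s * (a * c) * b ≡ a * (s * c * b)
      rearrange = solve-∀ ℚ-ring
      factor-out : ∀ j → sgn j * outer j k * B j ≡ coefficient k * (sgn j * choose x j * B j)
      factor-out j = begin
        sgn j * outer j k * B j
          ≡⟨ cong (λ z → sgn j * z * B j) (restrict-yes (+ d) t (outerTerm j) (divides (+ x) k-t≡xd)) ⟩
        sgn j * (coefficient k * binom (quot k t d) j) * B j
          ≡⟨ cong (λ y → sgn j * (coefficient k * binom y j) * B j) quot-exact ⟩
        sgn j * (coefficient k * choose x j) * B j
          ≡⟨ rearrange (sgn j) (coefficient k) (choose x j) (B j) ⟩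
        coefficient k * (sgn j * choose x j * B j)
          ∎

  column-sum-off : ∀ {M} k → ¬ + d ∣ (+ k ℤ.- t) →
                   sumTo M (λ j → sgn j * outer j k * binomialTransform inner j) ≡ target k
  column-sum-off {M} k d∤ = begin
    sumTo M (λ j → sgn j * outer j k * B j)
      ≡⟨ sumTo-cong M (λ j _ → cong (λ z → sgn j * z * B j) (restrict-no (+ d) t (outerTerm j) d∤)) ⟩
    sumTo M (λ j → sgn j * 0ℚ * B j)
      ≡⟨ sumTo-cong M (λ j _ → *-zero-middle (sgn j) (B j)) ⟩
    sumTo M (λ _ → 0ℚ)
      ≡⟨ sumTo-0 M ⟩
    0ℚ
      ≡⟨ restrict-no (+ (d ℕ.* q)) residue targetTerm (d∤ ∘ dq∣⇒d∣ k) ⟨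
    target k
      ∎
    where
    open ≡-Reasoning
    B : ℕ → ℚ
    B = binomialTransform inner

  column-sum : t ℤ.< + d → ∀ {M} → n ℕ.+ ℤ.∣ t ∣ ≤ M → ∀ k → k ≤ n →
               sumTo M (λ j → sgn j * outer j k * binomialTransform inner j) ≡ target k
  column-sum t<d {M} M≥ k k≤n with + d ∣? (+ k ℤ.- t)
  ... | no d∤ = column-sum-off {M} k d∤
  ... | yes d∣ with ∣⇒ℕ-quotient t<d d∣
  ...   | x , k-t≡xd = column-sum-on k-t≡xd
          (ℕP.≤-trans (quotient-bound {d} {k} {t} {x} k-t≡xd) (ℕP.≤-trans (ℕP.+-monoˡ-≤ ℤ.∣ t ∣ k≤n) M≥))

lemma3p1 : (d q : ℕ) .{{_ : NonZero d}} .{{_ : NonZero q}} (n l : ℕ) (r t : ℤ) →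
  t ℤ.< + d →
  ∃ λ N → ∀ M → M ≥ N →
    sumTo M (λ j → sgn j
        * sumDiv n (+ d) t (λ k → sgn k * binom (ι (+ n) ) k * binom (quot k t d) j)
        * sumDiv j (+ q) r (λ i → sgn i * binom (ι (+ j)) i * binom (quot i r q) l))
    ≡ sumDiv n (+ (d ℕ.* q)) ((+ d) ℤ.* r ℤ.+ t)
        (λ k → sgn k * binom (ι (+ n)) k * binom (quot k ((+ d) ℤ.* r ℤ.+ t) (d ℕ.* q) {{m*n≢0 d q}}) l)
lemma3p1 d q n l r t t<d = n ℕ.+ ℤ.∣ t ∣ , λ M M≥ → begin
  sumTo M (λ j → sgn j * sumTo n (outer′ j) * sumDiv j (+ q) r (λ i → sgn i * choose j i * innerTerm′ i))
    ≡⟨ sumTo-cong M (λ j _ → trans (cong (sgn j * sumTo n (outer′ j) *_) (inner-sum d q n l r t j))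
                                   (sumTo-*ˡʳ n (sgn j) (B j) (outer′ j))) ⟩
  sumTo M (λ j → sumTo n (λ k → sgn j * outer′ j k * B j))
    ≡⟨ sumTo-swap M n (λ j k → sgn j * outer′ j k * B j) ⟩
  sumTo n (λ k → sumTo M (λ j → sgn j * outer′ j k * B j))
    ≡⟨ sumTo-cong n (column-sum d q n l r t t<d M≥) ⟩
  sumTo n (target d q n l r t)
    ∎
  where
  open ≡-Reasoning
  outer′ : ℕ → ℕ → ℚ
  outer′ = outer d q n l r t
  innerTerm′ : ℕ → ℚ
  innerTerm′ = innerTerm d q n l r t
  B : ℕ → ℚ
  B = binomialTransform (inner d q n l r t)
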